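{- Let $f:\{0,1\}^n\to\{0,1\}$ be a symmetric Boolean function and let $a_1,\dots,a_{I(f)}\in\mathbb{R}^n$ be the anchors of an $I(f)$ interval-anchor assignment for $f$. Then $a_{ij}>a_{(i-1)j}$ for all $i\in\{2,\dots,I(f)\}$ and $j\in\{1,\dots,n\}$, where $a_{ij}$ denotes the $j$-th entry of $a_i$.
   Context: $|X|$ is the number of ones in $X$; $d$ is Euclidean distance. $f$ is symmetric if $f(X)$ depends only on $|X|$. The intervals of $f$ are the maximal sets of consecutive integers in $\{0,\dots,n\}$ on which $f$ (as a function of $|X|$) is constant; $I(f)$ is their number; ordered increasingly, the $i$-th interval is $\{I_{i-1}+1,\dots,I_i\}$ with $I_0=-1$. An NN representation of $f$ is a pair of disjoint finite sets $P,N\subset\mathbb{R}^n$ such that for every $X$ with $f(X)=1$ there is $p\in P$ with $d(X,p)<d(X,q)$ for all $q\in N$, and vice versa for $f(X)=0$. An $I(f)$ interval-anchor assignment for $f$ is an NN representation with exactly $I(f)$ anchors $a_1,\dots,a_{I(f)}$, $a_i$ positive iff $f=1$ on the $i$-th interval, such that every $X$ with $|X|$ in the $i$-th interval satisfies $d(X,a_i)<d(X,a_k)$ for all $k\ne i$. -}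

module Defs where

open import Data.Nat using (ℕ; zero; suc; _<ᵇ_)
import Data.Nat as Nat
open import Data.Bool using (Bool; true; false; if_then_else_)
open import Data.Fin using (Fin; zero; suc; toℕ; inject₁)
open import Data.Product using (Σ; _×_; _,_)
open import Data.Sum using (_⊎_)
open import Relation.Nullary using (¬_)
open import Relation.Binary.PropositionalEquality using (_≡_)

-- The real numbers, axiomatised as a complete ordered field
-- (with a square root, which is derivable in such a field but is
-- included as data so that the Euclidean distance can be written).

record RealField : Set₁ where
  infixl 6 _+_
  infixl 7 _*_
  infix 4 _<_
  field
    Carrier : Set
    _+_ _*_ : Carrier → Carrier → Carrier
    -_      : Carrier → Carrier
    0# 1#   : Carrier
    _<_     : Carrier → Carrier → Set
    +-assoc      : ∀ x y z → (x + y) + z ≡ x + (y + z)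
    +-comm       : ∀ x y → x + y ≡ y + x
    +-identityˡ  : ∀ x → 0# + x ≡ x
    -‿inverseˡ   : ∀ x → (- x) + x ≡ 0#
    *-assoc      : ∀ x y z → (x * y) * z ≡ x * (y * z)
    *-comm       : ∀ x y → x * y ≡ y * x
    *-identityˡ  : ∀ x → 1# * x ≡ x
    distribˡ     : ∀ x y z → x * (y + z) ≡ (x * y) + (x * z)
    0≢1          : ¬ (0# ≡ 1#)
    *-inverse    : ∀ x → ¬ (x ≡ 0#) → Σ Carrier (λ y → x * y ≡ 1#)
    <-irrefl     : ∀ x → ¬ (x < x)
    <-trans      : ∀ {x y z} → x < y → y < z → x < z
    <-trichotomy : ∀ x y → (x < y) ⊎ ((x ≡ y) ⊎ (y < x))
    +-mono-<     : ∀ {x y} z → x < y → x + z < y + z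
    *-pos        : ∀ {x y} → 0# < x → 0# < y → 0# < x * y
    sup          : (P : Carrier → Set) → Σ Carrier P →
                   Σ Carrier (λ b → ∀ x → P x → ¬ (b < x)) →
                   Σ Carrier (λ s → (∀ x → P x → ¬ (s < x)) ×
                                    (∀ b → (∀ x → P x → ¬ (b < x)) → ¬ (b < s)))
    sqrt         : Carrier → Carrier
    sqrt-nonneg  : ∀ x → ¬ (x < 0#) → ¬ (sqrt x < 0#)
    sqrt-square  : ∀ x → ¬ (x < 0#) → sqrt x * sqrt x ≡ x

Cube : ℕ → Set
Cube n = Fin n → Bool

weight : ∀ {n} → Cube n → ℕ
weight {zero}  X = 0
weight {suc n} X = (if X zero then 1 else 0) Nat.+ weight (λ j → X (suc j))

Symmetric : ∀ {n} → (Cube n → Bool) → Set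
Symmetric {n} f = ∀ (X Y : Cube n) → weight X ≡ weight Y → f X ≡ f Y

canon : ∀ n → ℕ → Cube n
canon n k j = toℕ j <ᵇ k

-- f as a function of |X| (meaningful for symmetric f, on 0..n)
valueAt : ∀ {n} → (Cube n → Bool) → ℕ → Bool
valueAt {n} f k = f (canon n k)

differ : Bool → Bool → ℕ
differ true  true  = 0
differ false false = 0
differ _     _     = 1

-- intervalIdx f k = (0-based) index of the interval containing weight k,
-- i.e. the number of m < k with valueAt f m ≠ valueAt f (m+1).
intervalIdx : ∀ {n} → (Cube n → Bool) → ℕ → ℕ
intervalIdx f zero    = 0
intervalIdx f (suc k) = intervalIdx f k Nat.+ differ (valueAt f k) (valueAt f (suc k))

numIntervals : ∀ {n} → (Cube n → Bool) → ℕ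
numIntervals {n} f = suc (intervalIdx f n)

module Geometry (R : RealField) where
  open RealField R

  Point : ℕ → Set
  Point n = Fin n → Carrier

  sumF : ∀ {n} → (Fin n → Carrier) → Carrier
  sumF {zero}  v = 0#
  sumF {suc n} v = v zero + sumF (λ j → v (suc j))

  embed : Bool → Carrier
  embed true  = 1#
  embed false = 0#

  dist : ∀ {n} → Cube n → Point n → Carrier
  dist X p = sqrt (sumF (λ j → (embed (X j) + (- p j)) * (embed (X j) + (- p j))))

  -- An I(f) interval-anchor assignment for f: anchors a_0,…,a_{I(f)-1}
  -- (0-based), with labels (a_i positive iff label i = true).
  record IntervalAnchorAssignment {n} (f : Cube n → Bool) : Set where
    field
      anchor : Fin (numIntervals f) → Point n
      label  : Fin (numIntervals f) → Bool
      label-correct : ∀ (i : Fin (numIntervals f)) (X : Cube n) →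
                      toℕ i ≡ intervalIdx f (weight X) → f X ≡ label i
      disjoint : ∀ (i k : Fin (numIntervals f)) → label i ≡ true → label k ≡ false →
                 ¬ (anchor i ≡ anchor k)
      nn-rep : ∀ (X : Cube n) → Σ (Fin (numIntervals f)) (λ i → label i ≡ f X ×
                 (∀ k → ¬ (label k ≡ f X) → dist X (anchor i) < dist X (anchor k)))
      interval-closest : ∀ (X : Cube n) (i k : Fin (numIntervals f)) →
                 toℕ i ≡ intervalIdx f (weight X) → ¬ (k ≡ i) →
                 dist X (anchor i) < dist X (anchor k)

{-# OPTIONS --safe #-}
-- Let the i-th interval end at weight k. Take X of weight k with X_j = 0 and let X' be X with
-- its j-th coordinate set to 1, so |X'| = k + 1 lies in the next interval. Then X is strictly
-- closer to a_i and X' to a_{i+1}, while flipping coordinate j changes every squared distance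
-- d(·,p)² by exactly 1 - 2 p_j. Comparing the two strict inequalities leaves 2 a_ij < 2 a_(i+1)j.
module Submission where

open import Defs
open import Data.Nat using (ℕ; zero; suc; z≤n)
open import Data.Nat.Properties using (1+n≢n)
open import Data.Bool using (Bool; true; false; if_then_else_)
open import Data.Fin using (Fin; zero; suc; toℕ; inject₁)
open import Data.Fin.Properties using (toℕ<n; toℕ-inject₁; suc-injective)
open import Data.Vec.Functional using (_∷_; updateAt)
open import Data.Vec.Functional.Properties using (updateAt-updates; updateAt-minimal)
open import Data.Product using (Σ-syntax; ∃-syntax; _×_; _,_)
open import Data.Sum using (inj₁; inj₂)
open import Data.Empty using (⊥-elim)
open import Function using (const; _∘_)
open import Relation.Nullary using (¬_; yes; no; contradiction)
open import Relation.Binary.PropositionalEquality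
  using (_≡_; _≢_; refl; sym; trans; cong; cong₂; subst; subst₂; isEquivalence; module ≡-Reasoning)
open import Algebra.Bundles using (CommutativeRing)
open import Algebra.Consequences.Propositional using (comm∧idˡ⇒id; comm∧invˡ⇒inv; comm∧distrˡ⇒distr)

module Cubes where
  open import Data.Nat using (_+_; _≤_; _<_; s≤s; s≤s⁻¹; _<?_)
  open import Data.Nat.Properties
    using (≤-antisym; ≤-trans; ≤-reflexive; ≮⇒≥; <⇒≱; m<n⇒m<1+n; n<1+n; +-suc; +-comm; +-monoʳ-≤)

  upcrossing : (s : ℕ → ℕ) → (∀ k → s (suc k) ≤ suc (s k)) →
               ∀ {i} m → s 0 ≤ i → i < s m →
               ∃[ k ] k < m × s k ≡ i × s (suc k) ≡ suc i
  upcrossing s step zero s0≤i i<s0 = contradiction s0≤i (<⇒≱ i<s0)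
  upcrossing s step {i} (suc m) s0≤i i<s[1+m] with i <? s m
  ... | yes i<sm = let k , k<m , sk≡i , s[1+k]≡1+i = upcrossing s step m s0≤i i<sm
                   in k , m<n⇒m<1+n k<m , sk≡i , s[1+k]≡1+i
  ... | no i≮sm = m , n<1+n m , sm≡i ,
                  ≤-antisym (subst (λ t → s (suc m) ≤ suc t) sm≡i (step m)) i<s[1+m]
    where
    sm≡i : s m ≡ i
    sm≡i = ≤-antisym (≮⇒≥ i≮sm) (s≤s⁻¹ (≤-trans i<s[1+m] (step m)))

  differ≤1 : ∀ b c → differ b c ≤ 1
  differ≤1 true  true  = z≤n
  differ≤1 true  false = s≤s z≤n
  differ≤1 false true  = s≤s z≤n
  differ≤1 false false = z≤n

  intervalIdx-suc-≤ : ∀ {n} (f : Cube n → Bool) k → intervalIdx f (suc k) ≤ suc (intervalIdx f k)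
  intervalIdx-suc-≤ f k =
    ≤-trans (+-monoʳ-≤ (intervalIdx f k) (differ≤1 _ _)) (≤-reflexive (+-comm (intervalIdx f k) 1))

  weight-canon : ∀ {n k} → k ≤ n → weight (canon n k) ≡ k
  weight-canon {zero}          z≤n     = refl
  weight-canon {suc n} {zero}  z≤n     = weight-canon {n} z≤n
  weight-canon {suc n} {suc k} (s≤s p) = cong suc (weight-canon p)

  cube-avoiding : ∀ {n k} (j : Fin n) → k < n → Σ[ X ∈ Cube n ] X j ≡ false × weight X ≡ k
  cube-avoiding {suc n} {k}     zero    (s≤s k≤n) = (false ∷ canon n k) , refl , weight-canon k≤n
  cube-avoiding {suc n} {zero}  (suc j) _         = canon (suc n) 0 , refl , weight-canon {suc n} z≤n
  cube-avoiding {suc n} {suc k} (suc j) (s≤s k<n) =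
    let X , Xj≡false , |X|≡k = cube-avoiding j k<n in (true ∷ X) , Xj≡false , cong suc |X|≡k

  weight-updateAt-true : ∀ {n} (X : Cube n) j → X j ≡ false →
                         weight (updateAt X j (const true)) ≡ suc (weight X)
  weight-updateAt-true X zero    Xj≡false rewrite Xj≡false = refl
  weight-updateAt-true X (suc j) Xj≡false =
    trans (cong (x₀ +_) (weight-updateAt-true (X ∘ suc) j Xj≡false)) (+-suc x₀ _)
    where
    x₀ : ℕ
    x₀ = if X zero then 1 else 0

module OrderedFieldProperties (R : RealField) where
  open RealField R

  commutativeRing : CommutativeRing _ _
  commutativeRing = record
    { isCommutativeRing = record
      { isRing = record
        { +-isAbelianGroup = record
          { isGroup = record
            { isMonoid = record
              { isSemigroup = record
                { isMagma = record { isEquivalence = isEquivalence ; ∙-cong = cong₂ _+_ }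
                ; assoc = +-assoc }
              ; identity = comm∧idˡ⇒id +-comm +-identityˡ }
            ; inverse = comm∧invˡ⇒inv +-comm -‿inverseˡ
            ; ⁻¹-cong = cong -_ }
          ; comm = +-comm }
        ; *-cong = cong₂ _*_
        ; *-assoc = *-assoc
        ; *-identity = comm∧idˡ⇒id *-comm *-identityˡ
        ; distrib = comm∧distrˡ⇒distr (cong₂ _+_) *-comm distribˡ }
      ; *-comm = *-comm } }

  open CommutativeRing commutativeRing public
    using (_-_; +-identityʳ; -‿inverseʳ; zeroˡ; +-group; +-commutativeSemigroup; commutativeSemiring)
  open import Algebra.Properties.Group +-group public
    using (//-rightDividesˡ; //-rightDividesʳ; ∙-cancelʳ; ⁻¹-involutive)
  open import Algebra.Properties.CommutativeSemigroup +-commutativeSemigroup public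
    using (xy∙z≈xz∙y; xy∙z≈zy∙x)
  open import Algebra.Properties.Ring (CommutativeRing.ring commutativeRing) public
    using (-‿distribˡ-*; -‿distribʳ-*)

  <-asym : ∀ {x y} → x < y → ¬ (y < x)
  <-asym x<y y<x = <-irrefl _ (<-trans x<y y<x)

  +-monoʳ-< : ∀ {x y} z → x < y → z + x < z + y
  +-monoʳ-< {x} {y} z x<y = subst₂ _<_ (+-comm x z) (+-comm y z) (+-mono-< z x<y)

  +-cancelʳ-< : ∀ {x y} z → x + z < y + z → x < y
  +-cancelʳ-< {x} {y} z p = subst₂ _<_ (//-rightDividesʳ z x) (//-rightDividesʳ z y) (+-mono-< (- z) p)

  +-cancelˡ-< : ∀ {x y} z → z + x < z + y → x < y
  +-cancelˡ-< {x} {y} z p = +-cancelʳ-< z (subst₂ _<_ (+-comm z x) (+-comm z y) p)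

  x+x<y+y⇒x<y : ∀ {x y} → x + x < y + y → x < y
  x+x<y+y⇒x<y {x} {y} p with <-trichotomy x y
  ... | inj₁ x<y        = x<y
  ... | inj₂ (inj₁ refl) = ⊥-elim (<-irrefl _ p)
  ... | inj₂ (inj₂ y<x) = ⊥-elim (<-asym p (<-trans (+-mono-< y y<x) (+-monoʳ-< x y<x)))

  <⇒0<- : ∀ {x y} → x < y → 0# < y - x
  <⇒0<- {x} p = subst₂ _<_ (-‿inverseʳ x) refl (+-mono-< (- x) p)

  *-monoˡ-< : ∀ {c x y} → 0# < c → x < y → c * x < c * y
  *-monoˡ-< {c} {x} {y} 0<c x<y =
    subst₂ _<_ (+-identityˡ (c * x)) c[y-x]+cx≡cy (+-mono-< (c * x) (*-pos 0<c (<⇒0<- x<y)))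
    where
    c[y-x]+cx≡cy : c * (y - x) + c * x ≡ c * y
    c[y-x]+cx≡cy = trans (sym (distribˡ c (y - x) x)) (cong (c *_) (//-rightDividesˡ x y))

  -x*-x≡x*x : ∀ x → (- x) * (- x) ≡ x * x
  -x*-x≡x*x x = begin
    (- x) * (- x)  ≡⟨ sym (-‿distribˡ-* x (- x)) ⟩
    - (x * (- x))  ≡⟨ cong -_ (sym (-‿distribʳ-* x x)) ⟩
    - (- (x * x))  ≡⟨ ⁻¹-involutive (x * x) ⟩
    x * x          ∎
    where open ≡-Reasoning

  square-nonneg : ∀ x → ¬ (x * x < 0#)
  square-nonneg x x²<0 with <-trichotomy x 0#
  ... | inj₁ x<0         = <-asym x²<0 (subst (0# <_) (-x*-x≡x*x x) (*-pos 0<-x 0<-x))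
    where
    0<-x : 0# < - x
    0<-x = subst (0# <_) (+-identityˡ (- x)) (<⇒0<- x<0)
  ... | inj₂ (inj₁ refl) = <-irrefl 0# (subst (_< 0#) (zeroˡ 0#) x²<0)
  ... | inj₂ (inj₂ 0<x)  = <-asym x²<0 (*-pos 0<x 0<x)

  +-nonneg : ∀ {x y} → ¬ (x < 0#) → ¬ (y < 0#) → ¬ (x + y < 0#)
  +-nonneg {x} {y} x≮0 y≮0 x+y<0 with <-trichotomy y 0#
  ... | inj₁ y<0         = y≮0 y<0
  ... | inj₂ (inj₁ refl) = x≮0 (subst (_< 0#) (+-identityʳ x) x+y<0)
  ... | inj₂ (inj₂ 0<y)  = x≮0 (<-trans (subst (_< x + y) (+-identityʳ x) (+-monoʳ-< x 0<y)) x+y<0)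

  square-mono-< : ∀ {s t} → ¬ (s < 0#) → s < t → s * s < t * t
  square-mono-< {s} {t} s≮0 s<t with <-trichotomy s 0#
  ... | inj₁ s<0         = ⊥-elim (s≮0 s<0)
  ... | inj₂ (inj₁ refl) = subst (_< t * t) (sym (zeroˡ 0#)) (*-pos s<t s<t)
  ... | inj₂ (inj₂ 0<s)  =
    <-trans (*-monoˡ-< 0<s s<t) (subst (_< t * t) (*-comm t s) (*-monoˡ-< (<-trans 0<s s<t) s<t))

  sqrt-cancel-< : ∀ {x y} → ¬ (x < 0#) → ¬ (y < 0#) → sqrt x < sqrt y → x < y
  sqrt-cancel-< {x} {y} x≮0 y≮0 p =
    subst₂ _<_ (sqrt-square x x≮0) (sqrt-square y y≮0) (square-mono-< (sqrt-nonneg x x≮0) p)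

  crossing⇒< : ∀ {x y x' y' u v c} → x < y → y' < x' → x' + u ≡ x + c → y' + v ≡ y + c → u < v
  crossing⇒< {x} {y} {x'} {y'} {u} {v} {c} x<y y'<x' x'+u≡x+c y'+v≡y+c =
    +-cancelˡ-< (x' + v) (subst₂ _<_ (sym [x'+v]+u≡[x+c]+v) refl
      (<-trans (subst ((x + c) + v <_) (cong (_+ v) (sym y'+v≡y+c)) (+-mono-< v (+-mono-< c x<y)))
               (+-mono-< v (+-mono-< v y'<x'))))
    where
    [x'+v]+u≡[x+c]+v : (x' + v) + u ≡ (x + c) + v
    [x'+v]+u≡[x+c]+v = trans (xy∙z≈xz∙y x' v u) (cong (_+ v) x'+u≡x+c)

module SquaredDistance (R : RealField) where
  open RealField R
  open Geometry R
  open OrderedFieldProperties R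
  open import Algebra.Solver.Ring.NaturalCoefficients.Default commutativeSemiring
    using (solve; _:=_; _:+_; _:*_; con)

  sqDiff : Carrier → Carrier → Carrier
  sqDiff x y = (x - y) * (x - y)

  sqDiff1u+2u≡1+sqDiff0u : ∀ u → sqDiff 1# u + (u + u) ≡ 1# + sqDiff 0# u
  sqDiff1u+2u≡1+sqDiff0u u = begin
    (1# + m) * (1# + m) + (u + u)        ≡⟨ expand m u ⟩
    (1# + m * m) + ((m + u) + (m + u))   ≡⟨ cong (λ z → (1# + m * m) + (z + z)) (-‿inverseˡ u) ⟩
    (1# + m * m) + (0# + 0#)             ≡⟨ cong ((1# + m * m) +_) (+-identityˡ 0#) ⟩
    (1# + m * m) + 0#                    ≡⟨ +-identityʳ _ ⟩
    1# + m * m                           ≡⟨ cong (λ z → 1# + z * z) (sym (+-identityˡ m)) ⟩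
    1# + (0# + m) * (0# + m)             ∎
    where
    open ≡-Reasoning
    m : Carrier
    m = - u
    -- The semiring solver knows no negation: - u enters as the atom m, and m + u = 0 is used after.
    expand : ∀ m u → (1# + m) * (1# + m) + (u + u) ≡ (1# + m * m) + ((m + u) + (m + u))
    expand = solve 2 (λ m u → (con 1 :+ m) :* (con 1 :+ m) :+ (u :+ u)
                               := (con 1 :+ m :* m) :+ ((m :+ u) :+ (m :+ u))) refl

  sumF-nonneg : ∀ {n} (v : Fin n → Carrier) → (∀ m → ¬ (v m < 0#)) → ¬ (sumF v < 0#)
  sumF-nonneg {zero}  v v≥0 = <-irrefl 0#
  sumF-nonneg {suc n} v v≥0 = +-nonneg (v≥0 zero) (sumF-nonneg (v ∘ suc) (v≥0 ∘ suc))

  sumF-cong : ∀ {n} {v w : Fin n → Carrier} → (∀ m → v m ≡ w m) → sumF v ≡ sumF w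
  sumF-cong {zero}  v≗w = refl
  sumF-cong {suc n} v≗w = cong₂ _+_ (v≗w zero) (sumF-cong (v≗w ∘ suc))

  sumF-exchange : ∀ {n} (v w : Fin n → Carrier) j → (∀ m → m ≢ j → v m ≡ w m) →
                  sumF w + v j ≡ sumF v + w j
  sumF-exchange {suc n} v w zero    v≗w =
    trans (cong (λ z → (w zero + z) + v zero) (sumF-cong (λ m → sym (v≗w (suc m) λ ()))))
          (xy∙z≈zy∙x (w zero) (sumF (v ∘ suc)) (v zero))
  sumF-exchange {suc n} v w (suc j) v≗w = begin
    (w zero + sumF (w ∘ suc)) + v (suc j)  ≡⟨ +-assoc _ _ _ ⟩
    w zero + (sumF (w ∘ suc) + v (suc j))  ≡⟨ cong₂ _+_ (sym (v≗w zero λ ())) ih ⟩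
    v zero + (sumF (v ∘ suc) + w (suc j))  ≡⟨ sym (+-assoc _ _ _) ⟩
    (v zero + sumF (v ∘ suc)) + w (suc j)  ∎
    where
    open ≡-Reasoning
    ih : sumF (w ∘ suc) + v (suc j) ≡ sumF (v ∘ suc) + w (suc j)
    ih = sumF-exchange (v ∘ suc) (w ∘ suc) j (λ m m≢j → v≗w (suc m) (m≢j ∘ suc-injective))

  sqDist : ∀ {n} → Cube n → Point n → Carrier
  sqDist X p = sumF (λ m → sqDiff (embed (X m)) (p m))

  sqDist-nonneg : ∀ {n} (X : Cube n) p → ¬ (sqDist X p < 0#)
  sqDist-nonneg X p = sumF-nonneg (λ m → sqDiff (embed (X m)) (p m)) (λ m → square-nonneg _)

  dist-<⇒sqDist-< : ∀ {n} (X : Cube n) {p q} → dist X p < dist X q → sqDist X p < sqDist X q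
  dist-<⇒sqDist-< X {p} {q} = sqrt-cancel-< (sqDist-nonneg X p) (sqDist-nonneg X q)

  sqDist-updateAt-true : ∀ {n} (X : Cube n) j p → X j ≡ false →
                         sqDist (updateAt X j (const true)) p + (p j + p j) ≡ sqDist X p + 1#
  sqDist-updateAt-true X j p Xj≡false = ∙-cancelʳ (sqDiff 0# u) _ _ (begin
    (S' + (u + u)) + sqDiff 0# u  ≡⟨ xy∙z≈xz∙y S' (u + u) (sqDiff 0# u) ⟩
    (S' + sqDiff 0# u) + (u + u)  ≡⟨ cong (_+ (u + u)) exchange ⟩
    (S + sqDiff 1# u) + (u + u)   ≡⟨ +-assoc S (sqDiff 1# u) (u + u) ⟩
    S + (sqDiff 1# u + (u + u))   ≡⟨ cong (S +_) (sqDiff1u+2u≡1+sqDiff0u u) ⟩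
    S + (1# + sqDiff 0# u)        ≡⟨ sym (+-assoc S 1# (sqDiff 0# u)) ⟩
    (S + 1#) + sqDiff 0# u        ∎)
    where
    open ≡-Reasoning
    X' : Cube _
    X' = updateAt X j (const true)
    u S S' : Carrier
    u = p j
    S = sqDist X p
    S' = sqDist X' p
    term : Cube _ → Fin _ → Carrier
    term Y m = sqDiff (embed (Y m)) (p m)
    exchange : S' + sqDiff 0# u ≡ S + sqDiff 1# u
    exchange = begin
      S' + sqDiff 0# u  ≡⟨ cong (λ b → S' + sqDiff (embed b) u) (sym Xj≡false) ⟩
      S' + term X j     ≡⟨ sumF-exchange (term X) (term X') j
                             (λ m m≢j → cong (λ b → sqDiff (embed b) (p m)) (sym (updateAt-minimal m j X m≢j))) ⟩
      S + term X' j     ≡⟨ cong (λ b → S + sqDiff (embed b) u) (updateAt-updates j X) ⟩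
      S + sqDiff 1# u   ∎

  coordinate-< : ∀ {n} (X : Cube n) j {a b : Point n} → X j ≡ false →
                 dist X a < dist X b →
                 dist (updateAt X j (const true)) b < dist (updateAt X j (const true)) a →
                 a j < b j
  coordinate-< X j {a} {b} Xj≡false X-nearer-a X'-nearer-b = x+x<y+y⇒x<y
    (crossing⇒< (dist-<⇒sqDist-< X X-nearer-a) (dist-<⇒sqDist-< (updateAt X j (const true)) X'-nearer-b)
                (sqDist-updateAt-true X j a Xj≡false) (sqDist-updateAt-true X j b Xj≡false))

open Cubes
open SquaredDistance using (coordinate-<)

proposition2 : (R : RealField) → (n : ℕ) → (f : Cube n → Bool) → Symmetric f →
    (A : Geometry.IntervalAnchorAssignment R f) →
    ∀ (i : Fin (intervalIdx f n)) (j : Fin n) →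
    RealField._<_ R (Geometry.IntervalAnchorAssignment.anchor A (inject₁ i) j)
    (Geometry.IntervalAnchorAssignment.anchor A (suc i) j)
proposition2 R n f _ A i j with upcrossing (intervalIdx f) (intervalIdx-suc-≤ f) n z≤n (toℕ<n i)
... | k , k<n , idx[k]≡i , idx[1+k]≡1+i with cube-avoiding j k<n
... | X , Xj≡false , |X|≡k =
  coordinate-< R X j Xj≡false
    (interval-closest X  (inject₁ i) (suc i)     X-in-interval-i  (inject₁≢suc ∘ sym))
    (interval-closest X' (suc i)     (inject₁ i) X'-in-interval-1+i inject₁≢suc)
  where
  open Geometry.IntervalAnchorAssignment A
  X' : Cube n
  X' = updateAt X j (const true)
  X-in-interval-i : toℕ (inject₁ i) ≡ intervalIdx f (weight X)
  X-in-interval-i = trans (toℕ-inject₁ i) (sym (trans (cong (intervalIdx f) |X|≡k) idx[k]≡i))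
  X'-in-interval-1+i : toℕ (suc i) ≡ intervalIdx f (weight X')
  X'-in-interval-1+i = sym (trans (cong (intervalIdx f) |X'|≡1+k) idx[1+k]≡1+i)
    where
    |X'|≡1+k : weight X' ≡ suc k
    |X'|≡1+k = trans (weight-updateAt-true X j Xj≡false) (cong suc |X|≡k)
  inject₁≢suc : inject₁ i ≢ suc i
  inject₁≢suc e = 1+n≢n (trans (cong toℕ (sym e)) (toℕ-inject₁ i))
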